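{- Let $p$ be a prime. None of the following integers belongs to the image of $Z_p:\mathbb{N}\to\mathbb{N}$: (a) $\frac{p^n-kp+k-1}{p-1}$ for integers $n>1$ and $1\leq k<n$; (b) $\left(\frac{p^k-1}{p-1}\right)p^n-k-h$ for integers $n>1$, $k\geq 1$ and $1\leq h<n$.
   Context: $Z_p(m)$ denotes the number of trailing zeroes in the base $p$ expansion of $m!$, i.e. the exponent of $p$ in $m!$. -}

module Defs where

open import Data.Nat using (ℕ; suc; _^_; _!)
open import Data.Nat.Divisibility using (_∣_)
open import Data.Product using (_×_; ∃)
open import Relation.Nullary using (¬_)

-- e is the exponent of p in m!, i.e. e = Z_p(m):
-- p^e divides m! but p^(e+1) does not.
IsZ : ℕ → ℕ → ℕ → Set
IsZ p m e = (p ^ e ∣ m !) × ¬ (p ^ suc e ∣ m !)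

InImageZ : ℕ → ℕ → Set
InImageZ p e = ∃ λ m → IsZ p m e

{-# OPTIONS --safe #-}
-- Legendre's recursion Z_p(pm) = m + Z_p(m) gives Z_p(p^n a) = a (1 + p + ⋯ + p^(n-1)) + Z_p(a).
-- Since Z_p is monotone and Z_p(M) − Z_p(M − 1) = v_p(M) ≥ j whenever p^j ∣ M, the values
-- Z_p(M) − h with 0 < h < j are skipped. The value in (a) is Z_p(p^n) − k; the value in (b)
-- is Z_p(M) − h for M = p^n (p^k − 1), using Z_p(p^k − 1) = (p^k − 1)/(p − 1) − k.
module Submission where

open import Defs
open import Data.Nat
open import Data.Nat.Properties
open import Data.Nat.Divisibility
open import Data.Nat.Primality using (Prime; euclidsLemma; prime⇒nonZero; prime⇒nonTrivial; ¬prime[0])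
open import Data.Nat.Tactic.RingSolver using (solve-∀)
open import Data.Product using (_×_; _,_; ∃)
open import Data.Sum using (inj₁; inj₂)
open import Relation.Binary.PropositionalEquality
open import Relation.Nullary using (¬_; contradiction; yes; no)

infix 4 _^_∥_

_^_∥_ : ℕ → ℕ → ℕ → Set
p ^ e ∥ n = p ^ e ∣ n × ¬ p ^ suc e ∣ n

^-monoʳ-∣ : ∀ p {m n} → m ≤ n → p ^ m ∣ p ^ n
^-monoʳ-∣ p {m} {n} m≤n = divides (p ^ (n ∸ m)) (begin
  p ^ n             ≡⟨ cong (p ^_) (sym (m∸n+n≡m m≤n)) ⟩
  p ^ (n ∸ m + m)   ≡⟨ ^-distribˡ-+-* p (n ∸ m) m ⟩
  p ^ (n ∸ m) * p ^ m ∎)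
  where open ≡-Reasoning

module _ {p : ℕ} .{{_ : NonZero p}} where

  ^*-∣ : ∀ d {e a} → p ^ e ∣ a → p ^ (d + e) ∣ p ^ d * a
  ^*-∣ d {e} e∣a = subst (_∣ _) (sym (^-distribˡ-+-* p d e)) (*-monoʳ-∣ (p ^ d) e∣a)

  ^*-∣-cancel : ∀ d {e a} → p ^ (d + e) ∣ p ^ d * a → p ^ e ∣ a
  ^*-∣-cancel d {e} d+e∣ =
    *-cancelˡ-∣ (p ^ d) {{m^n≢0 p d}} (subst (_∣ _) (^-distribˡ-+-* p d e) d+e∣)

  ^*-∥ : ∀ d {e a} → p ^ e ∥ a → p ^ (d + e) ∥ p ^ d * a
  ^*-∥ d {e} {a} (e∣a , e+1∤a) =
    ^*-∣ d e∣a ,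
    λ d+e+1∣ → e+1∤a (^*-∣-cancel d (subst (λ t → p ^ t ∣ p ^ d * a) (sym (+-suc d e)) d+e+1∣))

  ^*-∥-cancel : ∀ d {e a} → p ^ (d + e) ∥ p ^ d * a → p ^ e ∥ a
  ^*-∥-cancel d {e} {a} (d+e∣ , d+e+1∤) =
    ^*-∣-cancel d d+e∣ ,
    λ e+1∣a → d+e+1∤ (subst (λ t → p ^ t ∣ p ^ d * a) (+-suc d e) (^*-∣ d e+1∣a))

risingFactorial : ℕ → ℕ → ℕ
risingFactorial x zero    = 1
risingFactorial x (suc i) = risingFactorial x i * (x + i)

factorial-+ : ∀ n i → (n + i) ! ≡ n ! * risingFactorial (suc n) i
factorial-+ n zero    = trans (cong _! (+-identityʳ n)) (sym (*-identityʳ (n !)))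
factorial-+ n (suc i) = begin
  (n + suc i) !                                      ≡⟨ cong _! (+-suc n i) ⟩
  suc (n + i) * (n + i) !                            ≡⟨ cong (suc (n + i) *_) (factorial-+ n i) ⟩
  suc (n + i) * (n ! * risingFactorial (suc n) i)    ≡⟨ reorder (suc (n + i)) (n !) (risingFactorial (suc n) i) ⟩
  n ! * (risingFactorial (suc n) i * suc (n + i))    ∎
  where
  open ≡-Reasoning
  reorder : ∀ a b c → a * (b * c) ≡ b * (c * a)
  reorder = solve-∀

repunit : ℕ → ℕ → ℕ
repunit p zero    = 0
repunit p (suc n) = p ^ n + repunit p n

repunit*s+1≡[1+s]^n : ∀ s n → repunit (suc s) n * s + 1 ≡ suc s ^ n
repunit*s+1≡[1+s]^n s zero    = refl
repunit*s+1≡[1+s]^n s (suc n) = begin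
  (p ^ n + repunit p n) * s + 1     ≡⟨ distrib (p ^ n) (repunit p n) s ⟩
  p ^ n * s + (repunit p n * s + 1) ≡⟨ cong (p ^ n * s +_) (repunit*s+1≡[1+s]^n s n) ⟩
  p ^ n * s + p ^ n                 ≡⟨ collect (p ^ n) s ⟩
  p * p ^ n                         ∎
  where
  open ≡-Reasoning
  p : ℕ
  p = suc s
  distrib : ∀ a b t → (a + b) * t + 1 ≡ a * t + (b * t + 1)
  distrib = solve-∀
  collect : ∀ a t → a * t + a ≡ suc t * a
  collect = solve-∀

n≤repunit : ∀ p .{{_ : NonZero p}} n → n ≤ repunit p n
n≤repunit p zero    = z≤n
n≤repunit p (suc n) = +-mono-≤ (m^n>0 p n) (n≤repunit p n)

factorial-pred : ∀ n .{{_ : NonZero n}} → n ! ≡ n * pred n !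
factorial-pred (suc n) = refl

¬InImageZ-below : ∀ {p M e j y h} → 0 < M → IsZ p M e → p ^ j ∣ M →
                  y + h ≡ e → 1 ≤ h → h < j → ¬ InImageZ p y
¬InImageZ-below {p} {suc M} {e} {j} {y} {h} _ (pe∣M! , pe+1∤M!) pj∣M y+h≡e 1≤h h<j (m , py∣m! , py+1∤m!)
  with suc M ≤? m
... | yes M≤m = py+1∤m! (∣-trans (^-monoʳ-∣ p y<e) (∣-trans pe∣M! (m≤n⇒m!∣n! M≤m)))
  where
  y<e : y < e
  y<e = subst (y <_) y+h≡e (m<m+n y 1≤h)
... | no  M≰m = pe+1∤M! (∣-trans (^-monoʳ-∣ p e<j+y) pj+y∣M!)
  where
  e<j+y : e < j + y
  e<j+y = subst₂ _<_ y+h≡e (+-comm y j) (+-monoʳ-< y h<j)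
  pj+y∣M! : p ^ (j + y) ∣ suc M !
  pj+y∣M! = subst (_∣ suc M !) (sym (^-distribˡ-+-* p j y))
              (*-pres-∣ pj∣M (∣-trans py∣m! (m≤n⇒m!∣n! (<⇒≤pred (≰⇒> M≰m)))))

module _ {p : ℕ} (p-prime : Prime p) where

  private instance
    p≢0 : NonZero p
    p≢0 = prime⇒nonZero p-prime

  prime∤1 : ¬ p ∣ 1
  prime∤1 p∣1 = <⇒≱ (nonTrivial⇒n>1 p {{prime⇒nonTrivial p-prime}}) (∣⇒≤ p∣1)

  ^∣*-coprimeʳ : ∀ t {a w} → ¬ p ∣ w → p ^ t ∣ a * w → p ^ t ∣ a
  ^∣*-coprimeʳ zero    {a}     _   _  = 1∣ a
  ^∣*-coprimeʳ (suc t) {a} {w} p∤w pt+1∣aw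
    with euclidsLemma a w p-prime (m*n∣⇒m∣ p (p ^ t) pt+1∣aw)
  ... | inj₂ p∣w              = contradiction p∣w p∤w
  ... | inj₁ (divides a′ refl) =
    subst (p * p ^ t ∣_) (*-comm p a′) (*-monoʳ-∣ p (^∣*-coprimeʳ t p∤w pt∣a′w))
    where
    pt∣a′w : p ^ t ∣ a′ * w
    pt∣a′w = *-cancelˡ-∣ p
      (subst (p * p ^ t ∣_) (trans (cong (_* w) (*-comm a′ p)) (*-assoc p a′ w)) pt+1∣aw)

  ∥-*-coprimeʳ : ∀ {e a w} → ¬ p ∣ w → p ^ e ∥ a → p ^ e ∥ a * w
  ∥-*-coprimeʳ {e} {w = w} p∤w (e∣a , e+1∤a) =
    ∣-trans e∣a (m∣m*n w) , λ e+1∣aw → e+1∤a (^∣*-coprimeʳ (suc e) p∤w e+1∣aw)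

  prime∤risingFactorial : ∀ m {i} → i < p → ¬ p ∣ risingFactorial (suc (p * m)) i
  prime∤risingFactorial m {zero}  _     = prime∤1
  prime∤risingFactorial m {suc i} i+1<p p∣ with euclidsLemma _ (suc (p * m + i)) p-prime p∣
  ... | inj₁ p∣rest   = prime∤risingFactorial m (<-trans (n<1+n i) i+1<p) p∣rest
  ... | inj₂ p∣factor =
    <⇒≱ i+1<p (∣⇒≤ (∣m+n∣m⇒∣n (subst (p ∣_) (sym (+-suc (p * m) i)) p∣factor) (m∣m*n m)))

  factorial-p* : ∀ m → ∃ λ w → (p * m) ! ≡ p ^ m * m ! * w × ¬ p ∣ w
  factorial-p* zero    = 1 , cong _! (*-zeroʳ p) , prime∤1
  factorial-p* (suc m) with factorial-p* m
  ... | w , eq , p∤w = w * r , eq′ , p∤w*r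
    where
    r : ℕ
    r = risingFactorial (suc (p * m)) (pred p)

    n : ℕ
    n = p * m + pred p

    p*[1+m]≡1+n : p * suc m ≡ suc n
    p*[1+m]≡1+n = begin
      p * suc m              ≡⟨ *-suc p m ⟩
      p + p * m              ≡⟨ +-comm p (p * m) ⟩
      p * m + p              ≡⟨ cong (p * m +_) (sym (suc-pred p)) ⟩
      p * m + suc (pred p)   ≡⟨ +-suc (p * m) (pred p) ⟩
      suc n                  ∎
      where open ≡-Reasoning

    reorder : ∀ a b c d e f → e * f * (a * b * c * d) ≡ e * a * (f * b) * (c * d)
    reorder = solve-∀

    eq′ : (p * suc m) ! ≡ p ^ suc m * suc m ! * (w * r)
    eq′ = begin
      (p * suc m) !                       ≡⟨ cong _! p*[1+m]≡1+n ⟩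
      suc n * n !                         ≡⟨ cong₂ _*_ (sym p*[1+m]≡1+n) (factorial-+ (p * m) (pred p)) ⟩
      p * suc m * ((p * m) ! * r)         ≡⟨ cong (λ t → p * suc m * (t * r)) eq ⟩
      p * suc m * (p ^ m * m ! * w * r)   ≡⟨ reorder (p ^ m) (m !) w r p (suc m) ⟩
      p ^ suc m * suc m ! * (w * r)       ∎
      where open ≡-Reasoning

    p∤w*r : ¬ p ∣ w * r
    p∤w*r p∣w*r with euclidsLemma w r p-prime p∣w*r
    ... | inj₁ p∣w = p∤w p∣w
    ... | inj₂ p∣r = prime∤risingFactorial m (≤-reflexive (suc-pred p)) p∣r

  Z-p* : ∀ {m e} → IsZ p m e → IsZ p (p * m) (m + e)
  Z-p* {m} {e} z with factorial-p* m
  ... | w , eq , p∤w =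
    subst (p ^ (m + e) ∥_) (sym eq) (∥-*-coprimeʳ {m + e} p∤w (^*-∥ m {e} {m !} z))

  Z-1 : IsZ p 1 0
  Z-1 = 1∣ 1 , λ p∣1 → prime∤1 (subst (_∣ 1) (*-identityʳ p) p∣1)

  Z-p^ : ∀ n → IsZ p (p ^ n) (repunit p n)
  Z-p^ zero    = Z-1
  Z-p^ (suc n) = Z-p* (Z-p^ n)

  Z-p^* : ∀ {a e} → IsZ p a e → ∀ n → IsZ p (p ^ n * a) (a * repunit p n + e)
  Z-p^* {a} {e} z zero    = subst₂ (IsZ p) (sym (*-identityˡ a)) (cong (_+ e) (sym (*-zeroʳ a))) z
  Z-p^* {a} {e} z (suc n) =
    subst₂ (IsZ p) (sym (*-assoc p (p ^ n) a)) (regroup (p ^ n) a e (repunit p n)) (Z-p* (Z-p^* z n))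
    where
    regroup : ∀ x a e r → x * a + (a * r + e) ≡ a * (x + r) + e
    regroup = solve-∀

  Z-p^∸1 : ∀ k → IsZ p (p ^ k ∸ 1) (repunit p k ∸ k)
  Z-p^∸1 k = ^*-∥-cancel k (subst₂ (λ e n → p ^ e ∥ n)
    (sym (m+[n∸m]≡n (n≤repunit p k))) (factorial-pred (p ^ k) {{m^n≢0 p k}}) (Z-p^ k))

-- The hypothesis 1 < n is left unused: it follows from 1 ≤ k < n, resp. 1 ≤ h < n.
module _ {s : ℕ} (p-prime : Prime (suc s)) where

  private
    p : ℕ
    p = suc s

    instance
      s≢0 : NonZero s
      s≢0 = >-nonZero (s≤s⁻¹ (nonTrivial⇒n>1 p {{prime⇒nonTrivial p-prime}}))

  ¬InImageZ[repunit∸k] : (n k x : ℕ) → 1 < n → 1 ≤ k → k < n →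
    x * s + k * p ≡ p ^ n + k ∸ 1 → ¬ InImageZ p x
  ¬InImageZ[repunit∸k] n k x _ 1≤k k<n eq =
    ¬InImageZ-below (m^n>0 p n) (Z-p^ p-prime n) ∣-refl x+k≡repunit 1≤k k<n
    where
    open ≡-Reasoning
    regroup : ∀ x k s → (x + k) * s + k ≡ x * s + k * suc s
    regroup = solve-∀
    shift : ∀ a k → a + 1 + k ≡ suc (a + k)
    shift = solve-∀

    x+k≡repunit : x + k ≡ repunit p n
    x+k≡repunit = *-cancelʳ-≡ (x + k) (repunit p n) s (+-cancelʳ-≡ k _ _ (begin
      (x + k) * s + k                 ≡⟨ regroup x k s ⟩
      x * s + k * p                   ≡⟨ eq ⟩
      p ^ n + k ∸ 1                   ≡⟨ cong (λ t → t + k ∸ 1) (sym (repunit*s+1≡[1+s]^n s n)) ⟩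
      repunit p n * s + 1 + k ∸ 1     ≡⟨ cong (_∸ 1) (shift (repunit p n * s) k) ⟩
      repunit p n * s + k             ∎))

  ¬InImageZ[repunit*p^n∸k∸h] : (n k h r y : ℕ) → 1 < n → 1 ≤ k → 1 ≤ h → h < n →
    r * s ≡ p ^ k ∸ 1 → y + k + h ≡ r * p ^ n → ¬ InImageZ p y
  ¬InImageZ[repunit*p^n∸k∸h] n k h r y _ 1≤k 1≤h h<n r*s≡p^k∸1 eq =
    ¬InImageZ-below M>0 (Z-p^* p-prime (Z-p^∸1 p-prime k) n) (m∣m*n (p ^ k ∸ 1)) y+h≡e 1≤h h<n
    where
    open ≡-Reasoning
    R : ℕ → ℕ
    R = repunit p

    r≡R[k] : r ≡ R k
    r≡R[k] = *-cancelʳ-≡ r (R k) s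
      (trans r*s≡p^k∸1 (trans (cong (_∸ 1) (sym (repunit*s+1≡[1+s]^n s k))) (m+n∸n≡m (R k * s) 1)))

    M>0 : 0 < p ^ n * (p ^ k ∸ 1)
    M>0 = *-mono-≤ (m^n>0 p n)
      (subst (0 <_) r*s≡p^k∸1 (*-mono-≤ (subst (0 <_) (sym r≡R[k]) (≤-trans 1≤k (n≤repunit p k))) (>-nonZero⁻¹ s)))

    swap : ∀ y k h → y + h + k ≡ y + k + h
    swap = solve-∀
    expand : ∀ r a s → r * (a * s + 1) ≡ r * s * a + r
    expand = solve-∀
    rotate : ∀ b k e → b + (k + e) ≡ b + e + k
    rotate = solve-∀

    y+h≡e : y + h ≡ (p ^ k ∸ 1) * R n + (R k ∸ k)
    y+h≡e = +-cancelʳ-≡ k _ _ (begin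
      y + h + k                               ≡⟨ swap y k h ⟩
      y + k + h                               ≡⟨ eq ⟩
      r * p ^ n                               ≡⟨ cong (r *_) (sym (repunit*s+1≡[1+s]^n s n)) ⟩
      r * (R n * s + 1)                       ≡⟨ expand r (R n) s ⟩
      r * s * R n + r                         ≡⟨ cong₂ (λ a b → a * R n + b) r*s≡p^k∸1
                                                   (trans r≡R[k] (sym (m+[n∸m]≡n (n≤repunit p k)))) ⟩
      (p ^ k ∸ 1) * R n + (k + (R k ∸ k))     ≡⟨ rotate ((p ^ k ∸ 1) * R n) k (R k ∸ k) ⟩
      (p ^ k ∸ 1) * R n + (R k ∸ k) + k       ∎)

proposition3 : (p : ℕ) → Prime p →
    -- (a) x = (p^n - k p + k - 1)/(p - 1), with 1 < n and 1 ≤ k < n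
    ((n k x : ℕ) → 1 < n → 1 ≤ k → k < n →
      x * (p ∸ 1) + k * p ≡ p ^ n + k ∸ 1 → ¬ InImageZ p x)
    ×
    -- (b) y = ((p^k - 1)/(p - 1)) p^n - k - h, with 1 < n, 1 ≤ k, 1 ≤ h < n
    ((n k h r y : ℕ) → 1 < n → 1 ≤ k → 1 ≤ h → h < n →
      r * (p ∸ 1) ≡ p ^ k ∸ 1 → y + k + h ≡ r * p ^ n → ¬ InImageZ p y)
proposition3 zero    p-prime = contradiction p-prime ¬prime[0]
proposition3 (suc s) p-prime = ¬InImageZ[repunit∸k] p-prime , ¬InImageZ[repunit*p^n∸k∸h] p-prime
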